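{- Let $G$ be a finite simple graph and $\bar G$ its complement. Then (a) $\gamma^{\rm L}(G)=\gamma^{\rm L}(\bar G)$; (b) if $G$ has no closed twins, $\gamma^{\rm I}(G)=\gamma^{\rm O}(\bar G)$; (c) if $G$ has no open twins, $\gamma^{\rm O}(G)=\gamma^{\rm I}(\bar G)$; (d) if $G$ has neither open nor closed twins, $\gamma^{\rm F}(G)=\gamma^{\rm F}(\bar G)$.
   Context: For a graph $G=(V,E)$, $N(v)$ denotes the open and $N[v]=N(v)\cup\{v\}$ the closed neighborhood of $v$. Open twins are two non-adjacent vertices $u,v$ with $N(u)=N(v)$; closed twins are two adjacent vertices with $N[u]=N[v]$. A set $C\subseteq V$ is: a locating set (L-set) if the sets $N(v)\cap C$, $v\in V\setminus C$, are pairwise distinct; an open-separating set (O-set) if the sets $N(v)\cap C$, $v\in V$, are pairwise distinct; a closed-separating set (I-set) if the sets $N[v]\cap C$, $v\in V$, are pairwise distinct; a full-separating set (F-set) if it is both an O-set and an I-set. $\gamma^{\rm S}(G)$ is the minimum cardinality of an S-set of $G$ (defined when such a set exists). -}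

module Defs where

open import Data.Nat using (ℕ; _≤_)
open import Data.Bool using (Bool; true; false; not; _∨_)
open import Data.Fin using (Fin)
open import Data.Fin.Properties using (_≟_)
open import Data.Fin.Subset using (Subset; _∈_; _∉_; ∣_∣)
open import Data.Product using (Σ; _×_; _,_)
open import Relation.Nullary using (¬_; yes; no)
open import Relation.Nullary.Decidable using (⌊_⌋)
open import Relation.Binary.PropositionalEquality using (_≡_; _≢_; refl; sym)

record Graph (n : ℕ) : Set where
  field
    adj     : Fin n → Fin n → Bool
    adj-sym : ∀ u v → adj u v ≡ adj v u
    adj-irr : ∀ v → adj v v ≡ false
open Graph public

private
  compAdj : ∀ {n} → Graph n → Fin n → Fin n → Bool
  compAdj G u v with u ≟ v
  ... | yes _ = false
  ... | no _  = not (adj G u v)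

  compSym : ∀ {n} (G : Graph n) u v → compAdj G u v ≡ compAdj G v u
  compSym G u v with u ≟ v | v ≟ u
  ... | yes _ | yes _ = refl
  ... | yes refl | no q = Data.Empty.⊥-elim (q refl)
    where import Data.Empty
  ... | no p | yes refl = Data.Empty.⊥-elim (p refl)
    where import Data.Empty
  ... | no _ | no _ rewrite adj-sym G u v = refl

  compIrr : ∀ {n} (G : Graph n) v → compAdj G v v ≡ false
  compIrr G v with v ≟ v
  ... | yes _ = refl
  ... | no p = Data.Empty.⊥-elim (p refl)
    where import Data.Empty

complement : ∀ {n} → Graph n → Graph n
complement G = record { adj = compAdj G ; adj-sym = compSym G ; adj-irr = compIrr G }

cadj : ∀ {n} → Graph n → Fin n → Fin n → Bool
cadj G u w = ⌊ u ≟ w ⌋ ∨ adj G u w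

SameOpenTrace : ∀ {n} → Graph n → Subset n → Fin n → Fin n → Set
SameOpenTrace G C u v = ∀ w → w ∈ C → adj G u w ≡ adj G v w

SameClosedTrace : ∀ {n} → Graph n → Subset n → Fin n → Fin n → Set
SameClosedTrace G C u v = ∀ w → w ∈ C → cadj G u w ≡ cadj G v w

IsLocating : ∀ {n} → Graph n → Subset n → Set
IsLocating G C = ∀ u v → u ∉ C → v ∉ C → u ≢ v → ¬ SameOpenTrace G C u v

IsOpenSep : ∀ {n} → Graph n → Subset n → Set
IsOpenSep G C = ∀ u v → u ≢ v → ¬ SameOpenTrace G C u v

IsClosedSep : ∀ {n} → Graph n → Subset n → Set
IsClosedSep G C = ∀ u v → u ≢ v → ¬ SameClosedTrace G C u v

IsFullSep : ∀ {n} → Graph n → Subset n → Set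
IsFullSep G C = IsOpenSep G C × IsClosedSep G C

-- γ^S(G) = k : k is the minimum cardinality of an S-set of G
-- (in particular an S-set exists).
IsMinSize : ∀ {n} → (Graph n → Subset n → Set) → Graph n → ℕ → Set
IsMinSize S G k = Σ (Subset _) (λ C → S G C × ∣ C ∣ ≡ k) × (∀ C → S G C → k ≤ ∣ C ∣)

OpenTwins : ∀ {n} → Graph n → Fin n → Fin n → Set
OpenTwins G u v = u ≢ v × adj G u v ≡ false × (∀ w → adj G u w ≡ adj G v w)

ClosedTwins : ∀ {n} → Graph n → Fin n → Fin n → Set
ClosedTwins G u v = u ≢ v × adj G u v ≡ true × (∀ w → cadj G u w ≡ cadj G v w)

NoOpenTwins : ∀ {n} → Graph n → Set
NoOpenTwins G = ∀ u v → ¬ OpenTwins G u v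

NoClosedTwins : ∀ {n} → Graph n → Set
NoClosedTwins G = ∀ u v → ¬ ClosedTwins G u v

{-# OPTIONS --safe #-}
-- In the complement, a vertex w ≠ u is a neighbour of u iff it is not one in G,
-- so N_Ḡ(u) = V ∖ N_G[u] and N_Ḡ[u] = V ∖ N_G(u). Intersected with C, the open
-- traces in Ḡ are therefore the complements (within C) of the closed traces in G
-- and vice versa, and for u ∉ C the open traces in Ḡ and G are complements of each
-- other. Complementation within C is injective, so each kind of S-set of G is
-- exactly the corresponding kind of set of Ḡ, and the minimum sizes agree. The
-- twin-freeness hypotheses only guarantee that these sets exist; IsMinSize already
-- asserts existence.
module Submission where

open import Defs
open import Data.Nat using (ℕ)
open import Data.Bool using (Bool; not)
open import Data.Bool.Properties using (not-injective)
open import Data.Fin using (Fin)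
open import Data.Fin.Properties using (_≟_)
open import Data.Fin.Subset using (Subset; _∈_; _∉_)
open import Data.Product using (_×_; _,_)
open import Data.Empty using (⊥-elim)
open import Function.Base using (_∘_)
open import Function.Bundles using (_⇔_; mk⇔; Equivalence)
open import Relation.Nullary using (yes; no)
open import Relation.Binary.PropositionalEquality using (_≡_; _≢_; refl; sym; cong)

open Equivalence using (to; from)

≡⇔not-≡-not : ∀ {a b a′ b′ : Bool} → a′ ≡ not a → b′ ≡ not b → (a ≡ b) ⇔ (a′ ≡ b′)
≡⇔not-≡-not refl refl = mk⇔ (cong not) not-injective

AgreeOn : ∀ {n} → Subset n → (Fin n → Bool) → (Fin n → Bool) → Set
AgreeOn C f g = ∀ w → w ∈ C → f w ≡ g w

AgreeOn-not : ∀ {n} {C : Subset n} {f g f′ g′ : Fin n → Bool} →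
  AgreeOn C f′ (not ∘ f) → AgreeOn C g′ (not ∘ g) → AgreeOn C f g ⇔ AgreeOn C f′ g′
AgreeOn-not f′≡ g′≡ = mk⇔
  (λ same w w∈C → to   (≡⇔not-≡-not (f′≡ w w∈C) (g′≡ w w∈C)) (same w w∈C))
  (λ same w w∈C → from (≡⇔not-≡-not (f′≡ w w∈C) (g′≡ w w∈C)) (same w w∈C))

∉∧∈⇒≢ : ∀ {n} {C : Subset n} {u w : Fin n} → u ∉ C → w ∈ C → u ≢ w
∉∧∈⇒≢ u∉C w∈C refl = u∉C w∈C

IsMinSize-cong : ∀ {n} (S T : Graph n → Subset n → Set) (G H : Graph n) →
  (∀ C → S G C ⇔ T H C) → ∀ k → IsMinSize S G k ⇔ IsMinSize T H k
IsMinSize-cong S T G H S⇔T k = mk⇔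
  (λ ((C , sC , ∣C∣≡k) , minimal) → (C , to (S⇔T C) sC , ∣C∣≡k) , λ D → minimal D ∘ from (S⇔T D))
  (λ ((C , tC , ∣C∣≡k) , minimal) → (C , from (S⇔T C) tC , ∣C∣≡k) , λ D → minimal D ∘ to (S⇔T D))

module _ {n : ℕ} (G : Graph n) where

  private
    Ḡ : Graph n
    Ḡ = complement G

  adj-complement : ∀ {u w} → u ≢ w → adj Ḡ u w ≡ not (adj G u w)
  adj-complement {u} {w} u≢w with u ≟ w
  ... | yes u≡w = ⊥-elim (u≢w u≡w)
  ... | no _    = refl

  adj-complement-cadj : ∀ u w → adj Ḡ u w ≡ not (cadj G u w)
  adj-complement-cadj u w with u ≟ w
  ... | yes _ = refl
  ... | no _  = refl

  cadj-complement : ∀ u w → cadj Ḡ u w ≡ not (adj G u w)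
  cadj-complement u w with u ≟ w
  ... | yes refl = sym (cong not (adj-irr G u))
  ... | no _     = refl

  SameOpenTrace-complement : ∀ {C u v} → u ∉ C → v ∉ C →
    SameOpenTrace G C u v ⇔ SameOpenTrace Ḡ C u v
  SameOpenTrace-complement u∉C v∉C = AgreeOn-not
    (λ w w∈C → adj-complement (∉∧∈⇒≢ u∉C w∈C))
    (λ w w∈C → adj-complement (∉∧∈⇒≢ v∉C w∈C))

  SameClosedTrace⇔SameOpenTrace-complement : ∀ {C u v} →
    SameClosedTrace G C u v ⇔ SameOpenTrace Ḡ C u v
  SameClosedTrace⇔SameOpenTrace-complement {u = u} {v} =
    AgreeOn-not (λ w _ → adj-complement-cadj u w) (λ w _ → adj-complement-cadj v w)

  SameOpenTrace⇔SameClosedTrace-complement : ∀ {C u v} →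
    SameOpenTrace G C u v ⇔ SameClosedTrace Ḡ C u v
  SameOpenTrace⇔SameClosedTrace-complement {u = u} {v} =
    AgreeOn-not (λ w _ → cadj-complement u w) (λ w _ → cadj-complement v w)

  IsLocating-complement : ∀ C → IsLocating G C ⇔ IsLocating Ḡ C
  IsLocating-complement C = mk⇔
    (λ loc u v u∉C v∉C u≢v → loc u v u∉C v∉C u≢v ∘ from (SameOpenTrace-complement u∉C v∉C))
    (λ loc u v u∉C v∉C u≢v → loc u v u∉C v∉C u≢v ∘ to (SameOpenTrace-complement u∉C v∉C))

  IsClosedSep⇔IsOpenSep-complement : ∀ C → IsClosedSep G C ⇔ IsOpenSep Ḡ C
  IsClosedSep⇔IsOpenSep-complement C = mk⇔
    (λ sep u v u≢v → sep u v u≢v ∘ from SameClosedTrace⇔SameOpenTrace-complement)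
    (λ sep u v u≢v → sep u v u≢v ∘ to SameClosedTrace⇔SameOpenTrace-complement)

  IsOpenSep⇔IsClosedSep-complement : ∀ C → IsOpenSep G C ⇔ IsClosedSep Ḡ C
  IsOpenSep⇔IsClosedSep-complement C = mk⇔
    (λ sep u v u≢v → sep u v u≢v ∘ from SameOpenTrace⇔SameClosedTrace-complement)
    (λ sep u v u≢v → sep u v u≢v ∘ to SameOpenTrace⇔SameClosedTrace-complement)

  IsFullSep-complement : ∀ C → IsFullSep G C ⇔ IsFullSep Ḡ C
  IsFullSep-complement C = mk⇔
    (λ (openSep , closedSep) → to (IsClosedSep⇔IsOpenSep-complement C) closedSep
                             , to (IsOpenSep⇔IsClosedSep-complement C) openSep)
    (λ (openSep , closedSep) → from (IsOpenSep⇔IsClosedSep-complement C) closedSep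
                             , from (IsClosedSep⇔IsOpenSep-complement C) openSep)

theorem7 : ∀ {n} (G : Graph n) →
    (∀ k → IsMinSize IsLocating G k ⇔ IsMinSize IsLocating (complement G) k)
    × (NoClosedTwins G → ∀ k → IsMinSize IsClosedSep G k ⇔ IsMinSize IsOpenSep (complement G) k)
    × (NoOpenTwins G → ∀ k → IsMinSize IsOpenSep G k ⇔ IsMinSize IsClosedSep (complement G) k)
    × (NoOpenTwins G → NoClosedTwins G → ∀ k → IsMinSize IsFullSep G k ⇔ IsMinSize IsFullSep (complement G) k)
theorem7 G =
    IsMinSize-cong IsLocating IsLocating G (complement G) (IsLocating-complement G)
  , (λ _ → IsMinSize-cong IsClosedSep IsOpenSep G (complement G) (IsClosedSep⇔IsOpenSep-complement G))
  , (λ _ → IsMinSize-cong IsOpenSep IsClosedSep G (complement G) (IsOpenSep⇔IsClosedSep-complement G))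
  , (λ _ _ → IsMinSize-cong IsFullSep IsFullSep G (complement G) (IsFullSep-complement G))
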